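{- For every integer $d\ge1$, $s\chi(d)\ge 2d$.
   Context: A graph $G=(V,E)$ is strongly $k$-colorable if every graph obtained from $G$ by adding to it (the edges of) a union of pairwise vertex-disjoint cliques, each of size at most $k$, on the vertex set $V$ is $k$-colorable. The strong chromatic number $s\chi(G)$ is the minimum $k$ such that $G$ is strongly $k$-colorable, and $s\chi(d)=\max s\chi(G)$ over all finite graphs $G$ with maximum degree at most $d$. -}

module Defs where

open import Data.Nat using (ℕ; _≤_)
open import Data.Fin using (Fin; _≟_)
open import Data.Bool using (Bool; true; false; if_then_else_)
open import Data.List using (map; allFin)
open import Data.Nat.ListAction using (sum)
open import Data.Maybe using (Maybe; just; nothing)
open import Data.Product using (_×_; Σ; ∃-syntax)
open import Data.Sum using (_⊎_)
open import Relation.Nullary using (¬_; does)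
open import Relation.Binary.PropositionalEquality using (_≡_; _≢_)

record Graph : Set where
  field
    n      : ℕ
    adj    : Fin n → Fin n → Bool
    sym    : ∀ u v → adj u v ≡ adj v u
    irrefl : ∀ v → adj v v ≡ false
open Graph public

degree : (G : Graph) → Fin (n G) → ℕ
degree G v = sum (map (λ u → if adj G v u then 1 else 0) (allFin (n G)))

MaxDegreeAtMost : Graph → ℕ → Set
MaxDegreeAtMost G d = ∀ v → degree G v ≤ d

-- A union of pairwise vertex-disjoint cliques on V is encoded by a labelling:
-- vertex v lies in clique i iff lab v ≡ just i, and in no clique iff lab v ≡ nothing.
-- (At most |V| nonempty cliques exist, so labels in Fin n suffice.)
CliqueLabelling : Graph → Set
CliqueLabelling G = Fin (n G) → Maybe (Fin (n G))

inClique : (G : Graph) → CliqueLabelling G → Fin (n G) → Fin (n G) → Bool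
inClique G lab i v with lab v
... | just j  = does (j ≟ i)
... | nothing = false

cliqueSize : (G : Graph) → CliqueLabelling G → Fin (n G) → ℕ
cliqueSize G lab i = sum (map (λ v → if inClique G lab i v then 1 else 0) (allFin (n G)))

CliquesOfSizeAtMost : (G : Graph) → ℕ → CliqueLabelling G → Set
CliquesOfSizeAtMost G k lab = ∀ i → cliqueSize G lab i ≤ k

AdjPlus : (G : Graph) → CliqueLabelling G → Fin (n G) → Fin (n G) → Set
AdjPlus G lab u v = (adj G u v ≡ true) ⊎ (u ≢ v × ∃[ i ] (lab u ≡ just i × lab v ≡ just i))

ColourableWith : (G : Graph) → CliqueLabelling G → ℕ → Set
ColourableWith G lab k =
  Σ (Fin (n G) → Fin k) λ c → ∀ u v → AdjPlus G lab u v → c u ≢ c v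

StronglyColourable : Graph → ℕ → Set
StronglyColourable G k =
  (lab : CliqueLabelling G) → CliquesOfSizeAtMost G k lab → ColourableWith G lab k

-- sχ(G) ≥ m  (sχ(G) is the least k with G strongly k-colourable)
StrongChromaticAtLeast : Graph → ℕ → Set
StrongChromaticAtLeast G m = ∀ k → StronglyColourable G k → m ≤ k

module Submission where

-- K_{d,d} has maximum degree d.  Suppose it is strongly k-colourable with k < 2d.
--   * If d ≤ k, add each side of the bipartition as a clique (size d ≤ k):
--     the result is the complete graph on 2d vertices, so k ≥ 2d.
--   * If k < d, add a clique on k vertices of the left side: together with any
--     right vertex they span a complete graph on k + 1 vertices, so k ≥ k + 1.
-- Either way some set of vertices that is pairwise adjacent in G-plus-cliques
-- is larger than the number of colours, contradicting the pigeonhole principle.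

open import Defs
open import Data.Nat using (ℕ; zero; suc; pred; _+_; _*_; _∸_; _≤_; _<_; _<ᵇ_; z≤n; s≤s)
open import Data.Nat.Properties
  using (≤-refl; ≤-trans; ≤-reflexive; <-trans; <⇒≤; <⇒≱; ≰⇒>; ≮⇒≥; n≮n;
         pred[n]≤n; pred-mono-≤; 0∸n≡0; m+n∸m≡n; m<m+n; +-identityʳ; <ᵇ-reflects-<; _≤?_)
open import Data.Nat.ListAction using (sum)
open import Data.Fin as Fin using (Fin; toℕ; fromℕ<; inject≤)
open import Data.Fin.Properties
  using (toℕ<n; toℕ-fromℕ<; toℕ-inject≤; inject≤-injective; pigeonhole)
  renaming (<⇒≢ to <⇒≢ᶠ)
open import Data.Bool using (Bool; true; false; not; _xor_; if_then_else_)
open import Data.Bool.Properties using (xor-comm; xor-same)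
open import Data.List using (map; tabulate; allFin)
open import Data.List.Properties using (map-tabulate)
open import Data.Maybe using (just; nothing)
open import Data.Maybe.Properties using (just-injective)
open import Data.Product using (Σ; _×_; _,_)
open import Data.Sum using (_⊎_; inj₁; inj₂)
open import Data.Empty using (⊥; ⊥-elim)
open import Function using (_∘_; id)
open import Relation.Nullary using (¬_; yes; no)
open import Relation.Nullary.Reflects using (ofʸ; ofⁿ)
open import Relation.Binary.PropositionalEquality
  using (_≡_; _≢_; refl; trans; cong; subst)
  renaming (sym to ≡-sym)

indicator : Bool → ℕ
indicator b = if b then 1 else 0

-- Number of vertices of Fin n satisfying P.  Both `degree` and `cliqueSize`
-- of the definitions are, definitionally, instances of `count`.
count : ∀ {n} → (Fin n → Bool) → ℕ
count {n} P = sum (map (indicator ∘ P) (allFin n))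

pred∸pred≤∸ : ∀ a b → pred b ∸ pred a ≤ b ∸ a
pred∸pred≤∸ zero    b       = pred[n]≤n
pred∸pred≤∸ (suc a) zero    = ≤-reflexive (0∸n≡0 a)
pred∸pred≤∸ (suc a) (suc b) = ≤-refl

-- A predicate that only holds on indices in the interval [a, b) holds on at
-- most b ∸ a of them (stated for `tabulate`, which is what the induction needs).
sum-indicators-≤-interval : ∀ {n} (P : Fin n → Bool) a b →
  (∀ v → P v ≡ true → a ≤ toℕ v × toℕ v < b) →
  sum (tabulate (indicator ∘ P)) ≤ b ∸ a
sum-indicators-≤-interval {zero}  P a b inside = z≤n
sum-indicators-≤-interval {suc n} P a b inside with P Fin.zero in P0
... | false = ≤-trans (sum-indicators-≤-interval (P ∘ Fin.suc) (pred a) (pred b) shifted)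
                      (pred∸pred≤∸ a b)
  where
  shifted : ∀ v → P (Fin.suc v) ≡ true → pred a ≤ toℕ v × toℕ v < pred b
  shifted v Pv with inside (Fin.suc v) Pv
  ... | a≤v , s≤s v<b = pred-mono-≤ a≤v , v<b
... | true with inside Fin.zero P0
...   | z≤n , s≤s _ = s≤s (sum-indicators-≤-interval (P ∘ Fin.suc) 0 (pred b) shifted)
  where
  shifted : ∀ v → P (Fin.suc v) ≡ true → 0 ≤ toℕ v × toℕ v < pred b
  shifted v Pv with inside (Fin.suc v) Pv
  ... | _ , s≤s v<b = z≤n , v<b

count-≤-interval : ∀ {n} (P : Fin n → Bool) a b →
  (∀ v → P v ≡ true → a ≤ toℕ v × toℕ v < b) → count P ≤ b ∸ a
count-≤-interval {n} P a b inside =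
  subst (_≤ b ∸ a) (≡-sym (cong sum (map-tabulate id (indicator ∘ P))))
        (sum-indicators-≤-interval P a b inside)

clique-needs-colours : (G : Graph) (lab : CliqueLabelling G) (k : ℕ) {m : ℕ}
  (f : Fin m → Fin (n G)) →
  (∀ {i j} → i Fin.< j → AdjPlus G lab (f i) (f j)) →
  ColourableWith G lab k → m ≤ k
clique-needs-colours G lab k {m} f pairwise (c , proper) with m ≤? k
... | yes m≤k = m≤k
... | no  m≰k with pigeonhole (≰⇒> m≰k) (c ∘ f)
...   | i , j , i<j , same = ⊥-elim (proper (f i) (f j) (pairwise i<j) same)

inClique-label : (G : Graph) (lab : CliqueLabelling G) (i v : Fin (n G)) →
  inClique G lab i v ≡ true → lab v ≡ just i
inClique-label G lab i v member with lab v
... | just j with j Fin.≟ i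
...   | yes refl = refl
inClique-label G lab i v () | just j | no _
inClique-label G lab i v () | nothing

module CompleteBipartite (d : ℕ) where

  left : Fin (d + d) → Bool
  left v = toℕ v <ᵇ d

  K : Graph
  K = record
    { n      = d + d
    ; adj    = λ u v → left u xor left v
    ; sym    = λ u v → xor-comm (left u) (left v)
    ; irrefl = λ v → xor-same (left v)
    }

  lo hi : Bool → ℕ
  lo true  = 0
  lo false = d
  hi true  = d
  hi false = d + d

  side-interval : ∀ b v → left v ≡ b → lo b ≤ toℕ v × toℕ v < hi b
  side-interval b v _ with left v | <ᵇ-reflects-< (toℕ v) d
  side-interval true  v _  | true  | ofʸ v<d = z≤n , v<d
  side-interval false v _  | false | ofⁿ v≮d = ≮⇒≥ v≮d , toℕ<n v
  side-interval true  v () | false | _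
  side-interval false v () | true  | _

  side-length : ∀ b → hi b ∸ lo b ≡ d
  side-length true  = refl
  side-length false = m+n∸m≡n d d

  left-true : ∀ v → toℕ v < d → left v ≡ true
  left-true v v<d with left v | <ᵇ-reflects-< (toℕ v) d
  ... | true  | _       = refl
  ... | false | ofⁿ v≮d = ⊥-elim (v≮d v<d)

  left-false : ∀ v → d ≤ toℕ v → left v ≡ false
  left-false v d≤v with left v | <ᵇ-reflects-< (toℕ v) d
  ... | true  | ofʸ v<d = ⊥-elim (<⇒≱ v<d d≤v)
  ... | false | _       = refl

  one-side-count : (P : Fin (d + d) → Bool) (b : Bool) →
    (∀ v → P v ≡ true → left v ≡ b) → count P ≤ d
  one-side-count P b confined =
    subst (count P ≤_) (side-length b)
          (count-≤-interval P (lo b) (hi b) (λ v Pv → side-interval b v (confined v Pv)))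

  neighbour-side : ∀ u v → adj K u v ≡ true → left v ≡ not (left u)
  neighbour-side u v _ with left u | left v
  ... | true  | false = refl
  ... | false | true  = refl
  neighbour-side u v () | true  | true
  neighbour-side u v () | false | false

  max-degree : MaxDegreeAtMost K d
  max-degree u = one-side-count (adj K u) (not (left u)) (neighbour-side u)

  same-side-or-adjacent : ∀ u v → left u ≡ left v ⊎ adj K u v ≡ true
  same-side-or-adjacent u v with left u | left v
  ... | true  | true  = inj₁ refl
  ... | false | false = inj₁ refl
  ... | true  | false = inj₂ refl
  ... | false | true  = inj₂ refl

  adjacent-across : ∀ u v → left u ≡ false → left v ≡ true → adj K u v ≡ true
  adjacent-across u v lu lv rewrite lu | lv = refl

  -- From here on d ≥ 1, so that both sides are nonempty.
  module LowerBound (1≤d : 1 ≤ d) where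

    d<d+d : d < d + d
    d<d+d = m<m+n d 1≤d

    -- One representative vertex on each side: 0 on the left, d on the right.
    representative : Bool → Fin (d + d)
    representative true  = fromℕ< (≤-trans 1≤d (<⇒≤ d<d+d))
    representative false = fromℕ< d<d+d

    left-representative : ∀ b → left (representative b) ≡ b
    left-representative true  = left-true  _ (subst (_< d) (≡-sym (toℕ-fromℕ< _)) 1≤d)
    left-representative false = left-false _ (≤-reflexive (≡-sym (toℕ-fromℕ< d<d+d)))

    -- Case d ≤ k: making both sides cliques turns K_{d,d} into K_{2d},
    -- which needs 2d colours.
    sides-as-cliques : ∀ k → d ≤ k → StronglyColourable K k → d + d ≤ k
    sides-as-cliques k d≤k strong =
      clique-needs-colours K lab k id pairwise (strong lab small)
      where
      lab : CliqueLabelling K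
      lab v = just (representative (left v))

      members-share-side : ∀ i v → inClique K lab i v ≡ true → left v ≡ left i
      members-share-side i v member =
        trans (≡-sym (left-representative (left v)))
              (cong left (just-injective (inClique-label K lab i v member)))

      small : CliquesOfSizeAtMost K k lab
      small i = ≤-trans (one-side-count (inClique K lab i) (left i) (members-share-side i)) d≤k

      pairwise : ∀ {u v} → u Fin.< v → AdjPlus K lab u v
      pairwise {u} {v} u<v with same-side-or-adjacent u v
      ... | inj₁ same     = inj₂ (<⇒≢ᶠ u<v , representative (left u) , refl ,
                                  cong (just ∘ representative) (≡-sym same))
      ... | inj₂ adjacent = inj₁ adjacent

    -- Case k < d: a clique on the first k left vertices, together with one
    -- right vertex, forms a K_{k+1}, which cannot be k-coloured.
    short-clique : ∀ k → k < d → ¬ StronglyColourable K k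
    short-clique k k<d strong =
      n≮n k (clique-needs-colours K lab k spike pairwise (strong lab small))
      where
      lab : CliqueLabelling K
      lab v = if toℕ v <ᵇ k then just (representative true) else nothing

      members-below-k : ∀ i v → inClique K lab i v ≡ true → 0 ≤ toℕ v × toℕ v < k
      members-below-k i v member
        with toℕ v <ᵇ k | <ᵇ-reflects-< (toℕ v) k | inClique-label K lab i v member
      ... | true  | ofʸ v<k | _ = z≤n , v<k
      ... | false | _       | ()

      small : CliquesOfSizeAtMost K k lab
      small i = count-≤-interval (inClique K lab i) 0 k (members-below-k i)

      k≤d+d : k ≤ d + d
      k≤d+d = ≤-trans (<⇒≤ k<d) (<⇒≤ d<d+d)

      spike : Fin (suc k) → Fin (d + d)
      spike Fin.zero    = representative false
      spike (Fin.suc i) = inject≤ i k≤d+d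

      spike-below-k : ∀ i → toℕ (spike (Fin.suc i)) < k
      spike-below-k i = subst (_< k) (≡-sym (toℕ-inject≤ i k≤d+d)) (toℕ<n i)

      spike-left : ∀ i → left (spike (Fin.suc i)) ≡ true
      spike-left i = left-true _ (<-trans (spike-below-k i) k<d)

      spike-label : ∀ i → lab (spike (Fin.suc i)) ≡ just (representative true)
      spike-label i with toℕ (spike (Fin.suc i)) <ᵇ k | <ᵇ-reflects-< (toℕ (spike (Fin.suc i))) k
      ... | true  | _      = refl
      ... | false | ofⁿ ≮k = ⊥-elim (≮k (spike-below-k i))

      pairwise : ∀ {i j} → i Fin.< j → AdjPlus K lab (spike i) (spike j)
      pairwise {Fin.zero}  {Fin.suc j} _ =
        inj₁ (adjacent-across _ _ (left-representative false) (spike-left j))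
      pairwise {Fin.suc i} {Fin.suc j} i<j =
        inj₂ (distinct , representative true , spike-label i , spike-label j)
        where
        distinct : spike (Fin.suc i) ≢ spike (Fin.suc j)
        distinct eq = <⇒≢ᶠ i<j (cong Fin.suc (inject≤-injective k≤d+d k≤d+d i j eq))

    strong-chromatic : StrongChromaticAtLeast K (2 * d)
    strong-chromatic k strong with d ≤? k
    ... | yes d≤k = subst (_≤ k) (cong (d +_) (≡-sym (+-identityʳ d)))
                          (sides-as-cliques k d≤k strong)
    ... | no  d≰k = ⊥-elim (short-clique k (≰⇒> d≰k) strong)

theorem7p4 : (d : ℕ) → 1 ≤ d →
    Σ Graph λ G → MaxDegreeAtMost G d × StrongChromaticAtLeast G (2 * d)
theorem7p4 d 1≤d = K , max-degree , strong-chromatic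
  where
  open CompleteBipartite d
  open LowerBound 1≤d
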